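{- For all integers $n,k,p$ with $n\ge 9$, $\frac{n}{3}\ge k\ge 3$ and $p\ge \max\{k-1,\lceil \frac{n}{k-1}\rceil\}$, there exists a feasible homogeneous PV graph $\vec G_R$ with $n$ sites, $k$ carriers and period $p$ such that $$\mathcal M(\vec G_R)\ \ge\ (k-2)(p+1)+\left\lfloor \frac{n}{k-1}\right\rfloor .$$ This holds even if the agent knows $\vec G_R$, $k$ and $p$ and has unlimited memory.
   Context: A PV system consists of a finite set $S$ of $n$ sites and a set $C$ of $k\le n$ carriers; each carrier $c$ has a unique identifier and a route $\pi(c)=\langle x_0,\dots,x_{p(c)-1}\rangle$ of sites, with period $p(c)$ and $\pi(c)[j]=x_{j\bmod p(c)}$; at each time $t=0,1,\dots$ carrier $c$ moves from $\pi(c)[t]$ to $\pi(c)[t+1]$. The PV graph $\vec G_R$ is the directed edge-labelled multigraph on $S$ with edges $\bigcup_c\{(x_i,x_{i+1},i)\}$. Its period is $p=\max_c p(c)$; it is homogeneous if all periods are equal. An exploring agent is placed at time $0$ at a starting site $x\in\{\pi(c)[0]:c\in C\}$; at each time $t$, being at site $y$, it either halts or chooses a carrier $c$ with $\pi(c)[t]=y$ and moves with it to $\pi(c)[t+1]$ (one move). A concrete walk is a sequence of edges $(a_i,a_{i+1},i)$ with, for each $i$, a carrier $c_i$ having $\pi(c_i)[i]=a_i,\pi(c_i)[i+1]=a_{i+1}$; $\vec G_R$ is feasible if from every starting site there is a finite concrete walk visiting all sites. $\mathcal M(\vec G_R)$ denotes the number of moves that must be performed in the worst case to explore $\vec G_R$: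 the minimum, over all agent strategies (which may use complete knowledge of $\vec G_R$ and unlimited memory) that from every starting site visit all sites and halt, of the maximum over starting sites of the number of moves made. -}

module Defs where

open import Data.Nat using (ℕ; zero; suc; _+_; _*_; _∸_; _≤_; NonZero)
open import Data.Nat.DivMod using (_/_; _mod_)
open import Data.Fin using (Fin)
open import Data.Product using (Σ; ∃; _,_)
open import Data.List using (List; []; _∷_; length)
open import Data.List.Membership.Propositional using (_∈_)
open import Relation.Binary.PropositionalEquality using (_≡_)

-- A homogeneous PV system with n sites (Fin n), k carriers (Fin k, the
-- identifiers), all of period p: carrier c has route
-- ⟨ R c 0 , … , R c (p-1) ⟩.
PVSystem : ℕ → ℕ → ℕ → Set
PVSystem n k p = Fin k → Fin p → Fin n

π : ∀ {n k p} .{{_ : NonZero p}} → PVSystem n k p → Fin k → ℕ → Fin n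
π R c t = R c (t mod _)

StartSite : ∀ {n k p} .{{_ : NonZero p}} → PVSystem n k p → Fin n → Set
StartSite {k = k} R x = Σ (Fin k) λ c → π R c 0 ≡ x

-- A concrete walk of the agent being at site x at time t: it either halts,
-- or takes a carrier c with π(c)[t] = x to π(c)[t+1] (one move).
data Walk {n k p} .{{_ : NonZero p}} (R : PVSystem n k p) : ℕ → Fin n → Set where
  halt : ∀ {t x} → Walk R t x
  move : ∀ {t x} (c : Fin k) → π R c t ≡ x → Walk R (suc t) (π R c (suc t)) → Walk R t x

moves : ∀ {n k p} .{{_ : NonZero p}} {R : PVSystem n k p} {t x} → Walk R t x → ℕ
moves halt = 0
moves (move _ _ w) = suc (moves w)

visited : ∀ {n k p} .{{_ : NonZero p}} {R : PVSystem n k p} {t x} → Walk R t x → List (Fin n)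
visited {x = x} halt = x ∷ []
visited {x = x} (move _ _ w) = x ∷ visited w

Explores : ∀ {n k p} .{{_ : NonZero p}} {R : PVSystem n k p} {t x} → Walk R t x → Set
Explores {n = n} w = (y : Fin n) → y ∈ visited w

Feasible : ∀ {n k p} .{{_ : NonZero p}} → PVSystem n k p → Set
Feasible {n = n} R = (x : Fin n) → StartSite R x → Σ (Walk R 0 x) Explores

-- An exploration strategy of an agent with full knowledge of the system
-- and unlimited memory: for each starting site, a walk from it visiting all
-- sites and then halting.
Strategy : ∀ {n k p} .{{_ : NonZero p}} → PVSystem n k p → Set
Strategy {n = n} R = (x : Fin n) → StartSite R x → Σ (Walk R 0 x) Explores

-- B ≤ 𝓜(R): every exploration strategy makes at least B moves from some
-- starting site (𝓜 = min over strategies of max over starting sites).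
MovesAtLeast : ∀ {n k p} .{{_ : NonZero p}} → PVSystem n k p → ℕ → Set
MovesAtLeast {n = n} R B =
  (σ : Strategy R) → Σ (Fin n) λ x → Σ (StartSite R x) λ s →
    B ≤ moves (Data.Product.proj₁ (σ x s))

-- ⌊ m / d ⌋ and ⌈ m / d ⌉ (only used with d ≥ 1; value 0 for d = 0)
floorDiv : ℕ → ℕ → ℕ
floorDiv m zero = 0
floorDiv m (suc d) = m / suc d

ceilDiv : ℕ → ℕ → ℕ
ceilDiv m zero = 0
ceilDiv m (suc d) = (m + d) / suc d

module Submission where

-- Construction (m = k - 1 ≥ 2 arms plus a hub): site y is the cell
-- (y mod m, y / m) of a grid with m columns and at most p rows.  Arm i keeps to
-- column i, cycling through its rows once per period; it meets the hub at
-- phase i (in row 1, or row 2 for the special arm 1) and passes its key cell,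
-- row 0, once per period.  Arms meet nobody but the hub, and a key is visited
-- only by its own arm.  Feasibility: reach the hub, then ride every arm for a
-- full period.  Lower bound by the potential method (module PotentialBound):
-- a potential on (carrier, phase, pending keys) that vanishes at a halt and
-- drops by at most one per move; every key costs p + 1 moves, and the agent
-- placed on the special arm starts at potential (m - 1)(p + 1) + p.

open import Defs
open import Data.Nat using (ℕ; _+_; _*_; _∸_; _≤_; _⊔_; NonZero)
open import Data.Product using (Σ; _×_)

open import Data.Nat using (ℕ; zero; suc; _+_; _*_; _∸_; _≤_; _<_; _⊓_; _⊔_; NonZero; >-nonZero; >-nonZero⁻¹; z≤n; s≤s; s≤s⁻¹; _<?_; _≟_)
open import Data.Nat.Properties
open import Data.Nat.DivMod using (_%_; _/_; _mod_; %-distribˡ-+; m%n<n; m%n≤n; m%n≤m; m%n%n≡m%n; [m+n]%n≡m%n; [m+kn]%n≡m%n; m<n⇒m%n≡m; m≡m%n+[m/n]*n; m<n*o⇒m/o<n; /-monoˡ-≤)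
open import Data.Fin using (Fin; zero; suc; toℕ; fromℕ<)
open import Data.Fin.Properties using (toℕ-fromℕ<; toℕ<n; toℕ-injective)
import Data.Fin.Properties as Fin
open import Data.Fin.Subset using (Subset; _∈_; _∉_; _-_; ∣_∣; ⊤; Empty; ⁅_⁆; inside; outside)
open import Data.Fin.Subset.Properties using (_∈?_; ∈⊤; ∣⊤∣≡n; p─⊥≡p; p─q⊆p; p─q─q≡p─q; drop-not-there; nonempty?; Empty-unique; ∣⊥∣≡0)
open import Data.Vec.Base using (_∷_; here; there)
open import Data.Product using (Σ; _×_; _,_; proj₁; proj₂)
open import Data.Sum using (_⊎_; inj₁; inj₂)
open import Data.List using (List; []; _∷_)
open import Data.List.Membership.Propositional using () renaming (_∈_ to _∈ₗ_)
open import Data.List.Relation.Unary.Any as Any using ()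
open import Function using (_∘_)
open import Relation.Nullary using (Dec; yes; no; ¬_; contradiction)
open import Relation.Binary.PropositionalEquality

module _ {d : ℕ} .{{_ : NonZero d}} where

  toℕ-mod : ∀ x → toℕ (x mod d) ≡ x % d
  toℕ-mod x = toℕ-fromℕ< (m%n<n x d)

  toℕ-mod-< : ∀ {x} → x < d → toℕ (x mod d) ≡ x
  toℕ-mod-< {x} x<d = trans (toℕ-mod x) (m<n⇒m%n≡m x<d)

  mod-injective : ∀ {x y} → x < d → y < d → x mod d ≡ y mod d → x ≡ y
  mod-injective x<d y<d eq = trans (sym (toℕ-mod-< x<d)) (trans (cong toℕ eq) (toℕ-mod-< y<d))

-- Residues modulo p.  gap a b is the forward distance from phase a to phase
-- b: the number of steps, below p, after which phase a has become phase b.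
module Residues (p : ℕ) .{{_ : NonZero p}} where

  +-congˡ-% : ∀ c {a b} → a % p ≡ b % p → (c + a) % p ≡ (c + b) % p
  +-congˡ-% c {a} {b} eq = begin
    (c + a) % p          ≡⟨ %-distribˡ-+ c a p ⟩
    (c % p + a % p) % p  ≡⟨ cong (λ x → (c % p + x) % p) eq ⟩
    (c % p + b % p) % p  ≡⟨ %-distribˡ-+ c b p ⟨
    (c + b) % p          ∎
    where open ≡-Reasoning

  +-congʳ-% : ∀ c {a b} → a % p ≡ b % p → (a + c) % p ≡ (b + c) % p
  +-congʳ-% c {a} {b} eq = begin
    (a + c) % p  ≡⟨ cong (_% p) (+-comm a c) ⟩
    (c + a) % p  ≡⟨ +-congˡ-% c eq ⟩
    (c + b) % p  ≡⟨ cong (_% p) (+-comm c b) ⟩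
    (b + c) % p  ∎
    where open ≡-Reasoning

  complement-+ : ∀ a x → ((p ∸ a % p) + (a + x)) % p ≡ x % p
  complement-+ a x = begin
    ((p ∸ a % p) + (a + x)) % p      ≡⟨ +-congˡ-% (p ∸ a % p) (+-congʳ-% x (sym (m%n%n≡m%n a p))) ⟩
    ((p ∸ a % p) + (a % p + x)) % p  ≡⟨ cong (_% p) (sym (+-assoc (p ∸ a % p) (a % p) x)) ⟩
    ((p ∸ a % p) + a % p + x) % p    ≡⟨ cong (λ y → (y + x) % p) (m∸n+n≡m (m%n≤n a p)) ⟩
    (p + x) % p                      ≡⟨ cong (_% p) (+-comm p x) ⟩
    (x + p) % p                      ≡⟨ [m+n]%n≡m%n x p ⟩
    x % p                            ∎
    where open ≡-Reasoning

  +-cancelˡ-% : ∀ a {d e} → (a + d) % p ≡ (a + e) % p → d % p ≡ e % p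
  +-cancelˡ-% a {d} {e} eq =
    trans (sym (complement-+ a d)) (trans (+-congˡ-% (p ∸ a % p) eq) (complement-+ a e))

  <p-injective : ∀ {d e} → d < p → e < p → d % p ≡ e % p → d ≡ e
  <p-injective d<p e<p eq = trans (sym (m<n⇒m%n≡m d<p)) (trans eq (m<n⇒m%n≡m e<p))

  gap : ℕ → ℕ → ℕ
  gap a b = (b + (p ∸ a)) % p

  gap<p : ∀ a b → gap a b < p
  gap<p a b = m%n<n (b + (p ∸ a)) p

  gap-spec : ∀ {a} b → a ≤ p → (a + gap a b) % p ≡ b % p
  gap-spec {a} b a≤p = begin
    (a + (b + (p ∸ a)) % p) % p  ≡⟨ +-congˡ-% a (m%n%n≡m%n (b + (p ∸ a)) p) ⟩
    (a + (b + (p ∸ a))) % p      ≡⟨ cong (_% p) (+-comm a (b + (p ∸ a))) ⟩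
    (b + (p ∸ a) + a) % p        ≡⟨ cong (_% p) (+-assoc b (p ∸ a) a) ⟩
    (b + ((p ∸ a) + a)) % p      ≡⟨ cong (λ y → (b + y) % p) (m∸n+n≡m a≤p) ⟩
    (b + p) % p                  ≡⟨ [m+n]%n≡m%n b p ⟩
    b % p                        ∎
    where open ≡-Reasoning

  gap-unique : ∀ {a b d} → a ≤ p → d < p → (a + d) % p ≡ b % p → gap a b ≡ d
  gap-unique {a} {b} a≤p d<p eq =
    <p-injective (gap<p a b) d<p (+-cancelˡ-% a (trans (gap-spec b a≤p) (sym eq)))

  gap-self : ∀ {a} → a ≤ p → gap a a ≡ 0
  gap-self {a} a≤p = gap-unique a≤p (>-nonZero⁻¹ p) (cong (_% p) (+-identityʳ a))

  gap-injective : ∀ {a b c} → a ≤ p → b < p → c < p → gap a b ≡ gap a c → b ≡ c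
  gap-injective {a} {b} {c} a≤p b<p c<p eq = <p-injective b<p c<p (begin
    b % p            ≡⟨ gap-spec b a≤p ⟨
    (a + gap a b) % p ≡⟨ cong (λ g → (a + g) % p) eq ⟩
    (a + gap a c) % p ≡⟨ gap-spec c a≤p ⟩
    c % p            ∎)
    where open ≡-Reasoning

  gap-from-zero : ∀ {b} → b < p → gap 0 b ≡ b
  gap-from-zero b<p = gap-unique z≤n b<p refl

  gap-step : ∀ {a a′} b → a ≤ p → a′ ≤ p → a′ % p ≡ suc a % p → gap a b ≤ suc (gap a′ b)
  gap-step {a} {a′} b a≤p a′≤p next = begin
    gap a b              ≡⟨ gap-unique a≤p (m%n<n (suc g) p) shifted ⟩
    suc g % p            ≤⟨ m%n≤m (suc g) p ⟩
    suc g                ∎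
    where
      open ≤-Reasoning
      g : ℕ
      g = gap a′ b
      shifted : (a + suc g % p) % p ≡ b % p
      shifted = begin-equality
        (a + suc g % p) % p  ≡⟨ +-congˡ-% a (m%n%n≡m%n (suc g) p) ⟩
        (a + suc g) % p      ≡⟨ cong (_% p) (+-suc a g) ⟩
        (suc a + g) % p      ≡⟨ +-congʳ-% g (sym next) ⟩
        (a′ + g) % p         ≡⟨ gap-spec b a′≤p ⟩
        b % p                ∎

  phase : ℕ → ℕ
  phase t = toℕ (t mod p)

  phase<p : ∀ t → phase t < p
  phase<p t = toℕ<n (t mod p)

  phase≤p : ∀ t → phase t ≤ p
  phase≤p t = <⇒≤ (phase<p t)

  phase-< : ∀ {t} → t < p → phase t ≡ t
  phase-< = toℕ-mod-<

  phase-zero : phase 0 ≡ 0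
  phase-zero = phase-< (>-nonZero⁻¹ p)

  phase-period : ∀ t → phase (p + t) ≡ phase t
  phase-period t = trans (toℕ-mod (p + t))
    (trans (cong (_% p) (+-comm p t)) (trans ([m+n]%n≡m%n t p) (sym (toℕ-mod t))))

  phase-+ : ∀ t d → phase (t + d) % p ≡ (phase t + d) % p
  phase-+ t d = begin
    phase (t + d) % p  ≡⟨ cong (_% p) (toℕ-mod (t + d)) ⟩
    (t + d) % p % p    ≡⟨ m%n%n≡m%n (t + d) p ⟩
    (t + d) % p        ≡⟨ +-congʳ-% d (sym (trans (cong (_% p) (toℕ-mod t)) (m%n%n≡m%n t p))) ⟩
    (phase t + d) % p  ∎
    where open ≡-Reasoning

  phase-suc : ∀ t {j} → phase t ≡ j → suc j < p → phase (suc t) ≡ suc j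
  phase-suc t {j} ph sj<p = <p-injective (phase<p (suc t)) sj<p (begin
    phase (suc t) % p    ≡⟨ cong (λ u → phase u % p) (+-comm 1 t) ⟩
    phase (t + 1) % p    ≡⟨ phase-+ t 1 ⟩
    (phase t + 1) % p    ≡⟨ cong (λ x → (x + 1) % p) ph ⟩
    (j + 1) % p          ≡⟨ cong (_% p) (+-comm j 1) ⟩
    suc j % p            ∎)
    where open ≡-Reasoning

  gap-tick : ∀ t b → gap (phase t) b ≤ suc (gap (phase (suc t)) b)
  gap-tick t b = gap-step b (phase≤p t) (phase≤p (suc t))
    (trans (cong (λ u → phase u % p) (+-comm 1 t)) (trans (phase-+ t 1) (cong (_% p) (+-comm (phase t) 1))))

  gap-wait : ∀ t {b} → b < p → phase (gap (phase t) b + t) ≡ b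
  gap-wait t {b} b<p = <p-injective (phase<p _) b<p (begin
    phase (gap (phase t) b + t) % p  ≡⟨ cong (λ u → phase u % p) (+-comm (gap (phase t) b) t) ⟩
    phase (t + gap (phase t) b) % p  ≡⟨ phase-+ t _ ⟩
    (phase t + gap (phase t) b) % p  ≡⟨ gap-spec b (phase≤p t) ⟩
    b % p                            ∎)
    where open ≡-Reasoning

ind : ∀ {A : Set} → Dec A → ℕ
ind (yes _) = 1
ind (no _)  = 0

ind-yes : ∀ {A : Set} (d : Dec A) → A → ind d ≡ 1
ind-yes (yes _) _ = refl
ind-yes (no ¬a) a = contradiction a ¬a

ind-no : ∀ {A : Set} (d : Dec A) → ¬ A → ind d ≡ 0
ind-no (yes a) ¬a = contradiction a ¬a
ind-no (no _)  _  = refl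

ind≤1 : ∀ {A : Set} (d : Dec A) → ind d ≤ 1
ind≤1 (yes _) = ≤-refl
ind≤1 (no _)  = z≤n

ind-mono : ∀ {A B : Set} (a? : Dec A) (b? : Dec B) → (A → B) → ind a? ≤ ind b?
ind-mono (yes a) b? f = ≤-reflexive (sym (ind-yes b? (f a)))
ind-mono (no _)  b? f = z≤n

-- ifNonzero c x is x, except that it vanishes when c is 0 (no keys left).
ifNonzero : ℕ → ℕ → ℕ
ifNonzero zero    _ = 0
ifNonzero (suc _) x = x

ifNonzero-zero : ∀ {c} x → c ≡ 0 → ifNonzero c x ≡ 0
ifNonzero-zero x refl = refl

ifNonzero-suc : ∀ {c j} x → c ≡ suc j → ifNonzero c x ≡ x
ifNonzero-suc x refl = refl

ifNonzero-mono : ∀ c {x y} → (∀ {j} → c ≡ suc j → x ≤ suc y) → ifNonzero c x ≤ suc (ifNonzero c y)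
ifNonzero-mono zero    _ = z≤n
ifNonzero-mono (suc _) h = h refl

ifNonzero-≤ : ∀ c {x y} → x ≤ y → ifNonzero c x ≤ y
ifNonzero-≤ zero    _   = z≤n
ifNonzero-≤ (suc _) x≤y = x≤y

≤-ifNonzero : ∀ c {x z} → (c ≡ 0 → z ≡ 0) → z ≤ x → z ≤ ifNonzero c x
≤-ifNonzero zero    z≡0 _   = ≤-reflexive (z≡0 refl)
≤-ifNonzero (suc _) _   z≤x = z≤x

∸-tick : ∀ x y → x ∸ y ≤ suc (x ∸ suc y)
∸-tick x y with x ∸ y | pred[m∸n]≡m∸[1+n] x y
... | zero  | _  = z≤n
... | suc z | eq = ≤-reflexive (cong suc eq)

∸-bits : ∀ x c {d d′} → d ≤ 1 → d′ ≤ 1 → x ∸ (c + d) ≤ suc (x ∸ (c + d′))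
∸-bits x c {d} {d′} d≤1 d′≤1 = begin
  x ∸ (c + d)        ≤⟨ ∸-monoʳ-≤ x (m≤m+n c d) ⟩
  x ∸ c              ≤⟨ ∸-tick x c ⟩
  suc (x ∸ suc c)    ≡⟨ cong (λ y → suc (x ∸ y)) (+-comm 1 c) ⟩
  suc (x ∸ (c + 1))  ≤⟨ s≤s (∸-monoʳ-≤ x (+-monoʳ-≤ c d′≤1)) ⟩
  suc (x ∸ (c + d′)) ∎
  where open ≤-Reasoning

∣p∣≡1+∣p-x∣ : ∀ {k} {x : Fin k} {p : Subset k} → x ∈ p → ∣ p ∣ ≡ suc ∣ p - x ∣
∣p∣≡1+∣p-x∣ {x = zero}  {inside ∷ q}  here        = cong (λ r → suc ∣ r ∣) (sym (p─⊥≡p q))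
∣p∣≡1+∣p-x∣ {x = suc y} {inside ∷ q}  (there y∈q) = cong suc (∣p∣≡1+∣p-x∣ y∈q)
∣p∣≡1+∣p-x∣ {x = suc y} {outside ∷ q} (there y∈q) = ∣p∣≡1+∣p-x∣ y∈q

x∉p⇒p-x≡p : ∀ {k} {x : Fin k} {p : Subset k} → x ∉ p → p - x ≡ p
x∉p⇒p-x≡p {x = zero}  {inside ∷ q}  x∉p = contradiction here x∉p
x∉p⇒p-x≡p {x = zero}  {outside ∷ q} _   = cong (outside ∷_) (p─⊥≡p q)
x∉p⇒p-x≡p {x = suc y} {s ∷ q}       x∉p = cong (s ∷_) (x∉p⇒p-x≡p (drop-not-there x∉p))

x∉p-x : ∀ {k} {x : Fin k} {p : Subset k} → x ∉ p - x
x∉p-x {x = suc y} {s ∷ q} (there y∈q-y) = x∉p-x y∈q-y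

Empty⇒∣p∣≡0 : ∀ {k} {p : Subset k} → Empty p → ∣ p ∣ ≡ 0
Empty⇒∣p∣≡0 {k} empty = trans (cong ∣_∣ (Empty-unique empty)) (∣⊥∣≡0 k)

∈-singleton : ∀ {A : Set} {x y : A} → y ∈ₗ x ∷ [] → y ≡ x
∈-singleton (Any.here eq) = eq

module Riding {n k p} .{{_ : NonZero p}} (R : PVSystem n k p) where

  On : Fin k → ℕ → Set
  On c t = Walk R t (π R c t)

  ride : ∀ c t d → On c (d + t) → On c t
  ride c t zero    w = w
  ride c t (suc d) w = ride c t d (move c refl w)

  ride-keeps : ∀ c t d {w : On c (d + t)} {y} → y ∈ₗ visited w → y ∈ₗ visited (ride c t d w)
  ride-keeps c t zero    y∈w = y∈w
  ride-keeps c t (suc d) y∈w = ride-keeps c t d (Any.there y∈w)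

  ride-visits : ∀ c t d {w : On c (d + t)} {i} → i < d → π R c (i + t) ∈ₗ visited (ride c t d w)
  ride-visits c t (suc d) {w} {i} (s≤s i≤d) with m≤n⇒m<n∨m≡n i≤d
  ... | inj₁ i<d = ride-visits c t d i<d
  ... | inj₂ refl = ride-keeps c t d (Any.here refl)

  transfer : ∀ {t x x′} → x ≡ x′ → Walk R t x → Walk R t x′
  transfer e w = subst (Walk R _) e w

  transfer-keeps : ∀ {t x x′} (e : x ≡ x′) {w : Walk R t x} {y} →
                   y ∈ₗ visited w → y ∈ₗ visited (transfer e w)
  transfer-keeps refl y∈w = y∈w

module PotentialBound {n k p} .{{_ : NonZero p}} (R : PVSystem n k p)
  {Obligation : Set} (Met : Obligation → List (Fin n) → Set)
  (Φ : Fin k → ℕ → Obligation → ℕ)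
  (Φ-halt : ∀ c t o → Met o (π R c t ∷ []) → Φ c t o ≡ 0)
  (Φ-move : ∀ c c′ t o {L} → π R c′ t ≡ π R c t → Met o (π R c t ∷ L) →
            Σ Obligation λ o′ → Met o′ L × Φ c t o ≤ suc (Φ c′ (suc t) o′))
  where

  potential-bound : ∀ c t o (w : Walk R t (π R c t)) → Met o (visited w) → Φ c t o ≤ moves w
  potential-bound c t o halt met = ≤-reflexive (Φ-halt c t o met)
  potential-bound c t o (move c′ e w) met with Φ-move c c′ t o e met
  ... | o′ , met′ , drop = ≤-trans drop (s≤s (potential-bound c′ (suc t) o′ w met′))

-- The PV system with a hub (carrier 0) and m arms (carrier suc i is arm i),
-- under the size conditions that make it work; m ≤ p lets the hub meet every
-- arm within one period, and n ≤ m p gives every site a row below p.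
module Construction (m n p : ℕ) .{{_ : NonZero p}}
  (2≤m : 2 ≤ m) (3m≤n : 3 * m ≤ n) (m≤p : m ≤ p) (3≤p : 3 ≤ p) (n≤mp : n ≤ m * p) where

  instance
    m-nonZero : NonZero m
    m-nonZero = >-nonZero (≤-trans (s≤s z≤n) 2≤m)

    n-nonZero : NonZero n
    n-nonZero = >-nonZero (≤-trans (≤-trans (s≤s z≤n) 2≤m) (≤-trans (m≤n*m m 3) 3m≤n))

  open Residues p

  special : Fin m
  special = fromℕ< 2≤m

  meetRow′ : ℕ → ℕ
  meetRow′ 1 = 2
  meetRow′ _ = 1

  meetRow : Fin m → ℕ
  meetRow i = meetRow′ (toℕ i)

  altRow : Fin m → ℕ
  altRow i = 3 ∸ meetRow i

  -- The phase at which arm i passes its key site (row 0).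
  keyTime : Fin m → ℕ
  keyTime i = (toℕ i + (p ∸ meetRow i)) % p

  -- Nominal row of arm i at phase τ: the time elapsed since its key.
  row : Fin m → ℕ → ℕ
  row i τ = gap (keyTime i) τ

  cellCode : Fin m → ℕ → ℕ
  cellCode i r = toℕ i + m * r

  place : Fin m → ℕ → ℕ
  place i r with cellCode i r <? n
  ... | yes _ = r
  ... | no _  = altRow i

  hubArm : ℕ → Fin m
  hubArm τ = τ mod m

  position : Fin (suc m) → ℕ → ℕ
  position zero    τ = cellCode (hubArm τ) (meetRow (hubArm τ))
  position (suc i) τ = cellCode i (place i (row i τ))

  R : PVSystem n (suc m) p
  R c j = position c (toℕ j) mod n

  key : Fin m → Fin n
  key i = cellCode i 0 mod n

  meetRow-cases : ∀ x → (x ≡ 1 × meetRow′ x ≡ 2) ⊎ (x ≢ 1 × meetRow′ x ≡ 1)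
  meetRow-cases 0             = inj₂ ((λ ()) , refl)
  meetRow-cases 1             = inj₁ (refl , refl)
  meetRow-cases (suc (suc _)) = inj₂ ((λ ()) , refl)

  1≤meetRow : ∀ i → 1 ≤ meetRow i
  1≤meetRow i with meetRow-cases (toℕ i)
  ... | inj₁ (_ , e) = ≤-trans (s≤s z≤n) (≤-reflexive (sym e))
  ... | inj₂ (_ , e) = ≤-reflexive (sym e)

  meetRow≤2 : ∀ i → meetRow i ≤ 2
  meetRow≤2 i with meetRow-cases (toℕ i)
  ... | inj₁ (_ , e) = ≤-reflexive e
  ... | inj₂ (_ , e) = ≤-trans (≤-reflexive e) (s≤s z≤n)

  meetRow<p : ∀ i → meetRow i < p
  meetRow<p i = ≤-trans (s≤s (meetRow≤2 i)) 3≤p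

  altRow-cases : ∀ i → 1 ≤ altRow i × altRow i ≤ 2 × altRow i ≢ meetRow i
  altRow-cases i with meetRow-cases (toℕ i)
  ... | inj₁ (_ , e) rewrite e = s≤s z≤n , s≤s z≤n , (λ ())
  ... | inj₂ (_ , e) rewrite e = s≤s z≤n , ≤-refl , (λ ())

  low-row-valid : ∀ i {r} → r ≤ 2 → cellCode i r < n
  low-row-valid i {r} r≤2 = begin-strict
    toℕ i + m * r  <⟨ +-monoˡ-< (m * r) (toℕ<n i) ⟩
    m + m * r      ≤⟨ +-monoʳ-≤ m (*-monoʳ-≤ m r≤2) ⟩
    m + m * 2      ≡⟨ cong (m +_) (*-comm m 2) ⟩
    3 * m          ≤⟨ 3m≤n ⟩
    n              ∎
    where open ≤-Reasoning

  place-valid : ∀ i r → cellCode i (place i r) < n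
  place-valid i r with cellCode i r <? n
  ... | yes r<n = r<n
  ... | no _    = low-row-valid i (proj₁ (proj₂ (altRow-cases i)))

  place-id : ∀ i {r} → cellCode i r < n → place i r ≡ r
  place-id i {r} r<n with cellCode i r <? n
  ... | yes _   = refl
  ... | no r≮n = contradiction r<n r≮n

  place-cases : ∀ i r → place i r ≡ r ⊎ place i r ≡ altRow i
  place-cases i r with cellCode i r <? n
  ... | yes _ = inj₁ refl
  ... | no _  = inj₂ refl

  place-meet : ∀ i r → place i r ≡ meetRow i → r ≡ meetRow i
  place-meet i r e with place-cases i r
  ... | inj₁ e′ = trans (sym e′) e
  ... | inj₂ e′ = contradiction (trans (sym e′) e) (proj₂ (proj₂ (altRow-cases i)))

  place-zero : ∀ i r → place i r ≡ 0 → r ≡ 0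
  place-zero i r e with place-cases i r
  ... | inj₁ e′ = trans (sym e′) e
  ... | inj₂ e′ = contradiction (trans (sym e′) e) (λ z → <⇒≢ (proj₁ (altRow-cases i)) (sym z))

  position<n : ∀ c τ → position c τ < n
  position<n zero    τ = low-row-valid (hubArm τ) (meetRow≤2 (hubArm τ))
  position<n (suc i) τ = place-valid i (row i τ)

  cellCode-injective : ∀ {i j r s} → cellCode i r ≡ cellCode j s → i ≡ j × r ≡ s
  cellCode-injective {i} {j} {r} {s} eq = i≡j , *-cancelˡ-≡ r s m (+-cancelˡ-≡ (toℕ i) _ _ eq′)
    where
      column : ∀ k t → cellCode k t % m ≡ toℕ k
      column k t = trans (cong (λ x → (toℕ k + x) % m) (*-comm m t))
                         (trans ([m+kn]%n≡m%n (toℕ k) t m) (m<n⇒m%n≡m (toℕ<n k)))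
      i≡j : i ≡ j
      i≡j = toℕ-injective (trans (sym (column i r)) (trans (cong (_% m) eq) (column j s)))
      eq′ : toℕ i + m * r ≡ toℕ i + m * s
      eq′ = trans eq (cong (λ k → toℕ k + m * s) (sym i≡j))

  toℕ-special : toℕ special ≡ 1
  toℕ-special = toℕ-fromℕ< 2≤m

  hubArm-toℕ : ∀ i → hubArm (toℕ i) ≡ i
  hubArm-toℕ i = toℕ-injective (toℕ-mod-< (toℕ<n i))

  toℕ<p : ∀ (i : Fin m) → toℕ i < p
  toℕ<p i = ≤-trans (toℕ<n i) m≤p

  keyTime<p : ∀ i → keyTime i < p
  keyTime<p i = m%n<n _ p

  keyTime≤p : ∀ i → keyTime i ≤ p
  keyTime≤p i = <⇒≤ (keyTime<p i)

  row-at-meet : ∀ i → row i (toℕ i) ≡ meetRow i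
  row-at-meet i = gap-unique (keyTime≤p i) (meetRow<p i) (begin
    (keyTime i + meetRow i) % p                ≡⟨ +-congʳ-% (meetRow i) (m%n%n≡m%n _ p) ⟩
    (toℕ i + (p ∸ meetRow i) + meetRow i) % p  ≡⟨ cong (_% p) (+-assoc (toℕ i) _ _) ⟩
    (toℕ i + ((p ∸ meetRow i) + meetRow i)) % p ≡⟨ cong (λ x → (toℕ i + x) % p) (m∸n+n≡m (<⇒≤ (meetRow<p i))) ⟩
    (toℕ i + p) % p                            ≡⟨ [m+n]%n≡m%n (toℕ i) p ⟩
    toℕ i % p                                  ∎)
    where open ≡-Reasoning

  row-meet⇒ : ∀ i {τ} → τ < p → row i τ ≡ meetRow i → τ ≡ toℕ i
  row-meet⇒ i τ<p e = gap-injective (keyTime≤p i) τ<p (toℕ<p i) (trans e (sym (row-at-meet i)))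

  row-key⇒ : ∀ i {τ} → τ < p → row i τ ≡ 0 → τ ≡ keyTime i
  row-key⇒ i τ<p e = gap-injective (keyTime≤p i) τ<p (keyTime<p i) (trans e (sym (gap-self (keyTime≤p i))))

  gap-meet-key : ∀ i → gap (toℕ i) (keyTime i) ≡ p ∸ meetRow i
  gap-meet-key i = gap-unique (<⇒≤ (toℕ<p i)) (∸-monoʳ-< (1≤meetRow i) (<⇒≤ (meetRow<p i)))
                              (sym (m%n%n≡m%n _ p))

  data Meeting : Fin (suc m) → Fin (suc m) → ℕ → Set where
    same    : ∀ {c τ} → Meeting c c τ
    hub-arm : ∀ i → Meeting zero (suc i) (toℕ i)
    arm-hub : ∀ i → Meeting (suc i) zero (toℕ i)

  hub-meets : ∀ i {τ} → τ < p → position zero τ ≡ position (suc i) τ → τ ≡ toℕ i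
  hub-meets i {τ} τ<p eq with cellCode-injective eq
  ... | refl , e = row-meet⇒ (hubArm τ) τ<p (place-meet (hubArm τ) _ (sym e))

  -- Arms occupy different columns, so only the hub and an arm can meet.
  meeting : ∀ c c′ {τ} → τ < p → position c τ ≡ position c′ τ → Meeting c c′ τ
  meeting zero    zero    _   _  = same
  meeting zero    (suc i) τ<p eq = subst (Meeting zero (suc i)) (sym (hub-meets i τ<p eq)) (hub-arm i)
  meeting (suc i) zero    τ<p eq = subst (Meeting (suc i) zero) (sym (hub-meets i τ<p (sym eq))) (arm-hub i)
  meeting (suc i) (suc j) _   eq with cellCode-injective eq
  ... | refl , _ = same

  colocated : ∀ c c′ t → π R c t ≡ π R c′ t → Meeting c c′ (phase t)
  colocated c c′ t eq =
    meeting c c′ (phase<p t) (mod-injective (position<n c (phase t)) (position<n c′ (phase t)) eq)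

  key-located : ∀ i c t → key i ≡ π R c t → c ≡ suc i × phase t ≡ keyTime i
  key-located i c t eq with mod-injective (low-row-valid i z≤n) (position<n c (phase t)) eq
  key-located i zero    t _ | eq′ = contradiction (proj₂ (cellCode-injective eq′)) (<⇒≢ (1≤meetRow (hubArm (phase t))))
  key-located i (suc j) t _ | eq′ with cellCode-injective eq′
  ... | refl , e = refl , row-key⇒ i (phase<p t) (place-zero i _ (sym e))

  meets-hub : ∀ i t → phase t ≡ toℕ i → π R (suc i) t ≡ π R zero t
  meets-hub i t ph = cong (_mod n) (begin
    cellCode i (place i (row i (phase t)))  ≡⟨ cong (λ τ → cellCode i (place i (row i τ))) ph ⟩
    cellCode i (place i (row i (toℕ i)))    ≡⟨ cong (λ r → cellCode i (place i r)) (row-at-meet i) ⟩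
    cellCode i (place i (meetRow i))        ≡⟨ cong (cellCode i) (place-id i (low-row-valid i (meetRow≤2 i))) ⟩
    cellCode i (meetRow i)                  ≡⟨ cong (λ j → cellCode j (meetRow j)) (sym (trans (cong hubArm ph) (hubArm-toℕ i))) ⟩
    position zero (phase t)                 ∎)
    where open ≡-Reasoning

  open Riding R

  arm-sweeps-column : ∀ a t (y : Fin n) → toℕ y % m ≡ toℕ a →
                      Σ ℕ λ d → d < p × π R (suc a) (d + t) ≡ y
  arm-sweeps-column a t y col = d , gap<p (phase t) τ* , toℕ-injective (begin
      toℕ (π R (suc a) (d + t))                           ≡⟨ toℕ-mod (position (suc a) (phase (d + t))) ⟩
      cellCode a (place a (row a (phase (d + t)))) % n    ≡⟨ cong (λ τ → cellCode a (place a (row a τ)) % n) (gap-wait t τ*<p) ⟩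
      cellCode a (place a (row a τ*)) % n                 ≡⟨ cong (λ x → cellCode a (place a x) % n) row≡r ⟩
      cellCode a (place a r) % n                          ≡⟨ cong (λ x → cellCode a x % n) (place-id a (subst (_< n) y≡cell (toℕ<n y))) ⟩
      cellCode a r % n                                    ≡⟨ cong (_% n) (sym y≡cell) ⟩
      toℕ y % n                                           ≡⟨ m<n⇒m%n≡m (toℕ<n y) ⟩
      toℕ y                                               ∎)
    where
      open ≡-Reasoning
      r : ℕ
      r = toℕ y / m
      y≡cell : toℕ y ≡ cellCode a r
      y≡cell = trans (m≡m%n+[m/n]*n (toℕ y) m) (cong₂ _+_ col (*-comm r m))
      r<p : r < p
      r<p = m<n*o⇒m/o<n (≤-trans (toℕ<n y) (≤-trans n≤mp (≤-reflexive (*-comm m p))))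
      τ* : ℕ
      τ* = (keyTime a + r) % p
      τ*<p : τ* < p
      τ*<p = m%n<n (keyTime a + r) p
      row≡r : row a τ* ≡ r
      row≡r = gap-unique (keyTime≤p a) r<p (sym (m%n%n≡m%n _ p))
      d : ℕ
      d = gap (phase t) τ*

  CoversFrom : ∀ {t x} → ℕ → Walk R t x → Set
  CoversFrom j w = ∀ (y : Fin n) → j ≤ toℕ y % m → y ∈ₗ visited w

  -- Starting on arm j at its meeting phase, ride each of the arms j, j+1, …, m-1
  -- for a full period, changing via the hub from one to the next.
  sweep : ∀ ℓ j t → j + suc ℓ ≡ m → phase t ≡ j → Σ (On (suc (hubArm j)) t) (CoversFrom j)
  onward : ∀ ℓ j t → j + suc ℓ ≡ m → phase t ≡ j → Σ (On (suc (hubArm j)) (p + t)) (CoversFrom (suc j))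

  sweep ℓ j t e ph = ride (suc (hubArm j)) t p (proj₁ rest) , covers
    where
      rest : Σ (On (suc (hubArm j)) (p + t)) (CoversFrom (suc j))
      rest = onward ℓ j t e ph
      covers : CoversFrom j (ride (suc (hubArm j)) t p (proj₁ rest))
      covers y j≤col with toℕ y % m ≟ j
      ... | no col≢j  = ride-keeps _ t p (proj₂ rest y (≤∧≢⇒< j≤col (col≢j ∘ sym)))
      ... | yes col≡j = subst (_∈ₗ _) (proj₂ (proj₂ hit)) (ride-visits _ t p (proj₁ (proj₂ hit)))
        where
          hit : Σ ℕ λ d → d < p × π R (suc (hubArm j)) (d + t) ≡ y
          hit = arm-sweeps-column (hubArm j) t y
                  (trans col≡j (sym (toℕ-mod-< (subst (j <_) e (m<m+n j (s≤s z≤n))))))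

  onward zero j t e _ = halt , λ y sj≤col →
    contradiction (subst (toℕ y % m <_) (sym (trans (+-comm 1 j) e)) (m%n<n (toℕ y) m)) (≤⇒≯ sj≤col)
  onward (suc ℓ) j t e ph =
    transfer leave (ride zero (p + t) 1 (transfer enter (proj₁ next))) ,
    λ y sj≤col → transfer-keeps leave (ride-keeps zero (p + t) 1 (transfer-keeps enter (proj₂ next y sj≤col)))
    where
      sj<m : suc j < m
      sj<m = subst (suc j <_) e (subst (suc j <_) (sym (+-suc j (suc ℓ))) (s≤s (m<m+n j (s≤s z≤n))))
      at-j : phase (p + t) ≡ toℕ (hubArm j)
      at-j = trans (phase-period t) (trans ph (sym (toℕ-mod-< (<-trans (n<1+n j) sj<m))))
      next-phase : phase (suc (p + t)) ≡ suc j
      next-phase = phase-suc (p + t) (trans (phase-period t) ph) (≤-trans sj<m m≤p)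
      at-next : phase (suc (p + t)) ≡ toℕ (hubArm (suc j))
      at-next = trans next-phase (sym (toℕ-mod-< sj<m))
      next : Σ (On (suc (hubArm (suc j))) (suc (p + t))) (CoversFrom (suc j))
      next = sweep ℓ (suc j) (suc (p + t)) (trans (sym (+-suc j (suc ℓ))) e) next-phase
      leave : π R zero (p + t) ≡ π R (suc (hubArm j)) (p + t)
      leave = sym (meets-hub (hubArm j) (p + t) at-j)
      enter : π R (suc (hubArm (suc j))) (suc (p + t)) ≡ π R zero (suc (p + t))
      enter = meets-hub (hubArm (suc j)) (suc (p + t)) at-next

  fromHub : ∀ t → phase t ≡ 0 → Σ (On zero t) Explores
  fromHub t ph = transfer enter (proj₁ all) , λ y → transfer-keeps enter (proj₂ all y z≤n)
    where
      0<m : 0 < m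
      0<m = ≤-trans (s≤s z≤n) 2≤m
      enter : π R (suc (hubArm 0)) t ≡ π R zero t
      enter = meets-hub (hubArm 0) t (trans ph (sym (toℕ-mod-< 0<m)))
      all : Σ (On (suc (hubArm 0)) t) (CoversFrom 0)
      all = sweep (m ∸ 1) 0 t (m+[n∸m]≡n 0<m) ph

  -- From arm i, ride to its meeting with the hub, then ride the hub to phase 0.
  start : ∀ c → Σ (On c 0) Explores
  start zero    = fromHub 0 phase-zero
  start (suc i) =
    ride (suc i) 0 (toℕ i) (transfer leave (ride zero (toℕ i + 0) (p ∸ toℕ i) (proj₁ tour))) ,
    λ y → ride-keeps (suc i) 0 (toℕ i) (transfer-keeps leave (ride-keeps zero _ (p ∸ toℕ i) (proj₂ tour y)))
    where
      at-meet : phase (toℕ i + 0) ≡ toℕ i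
      at-meet = trans (cong phase (+-identityʳ (toℕ i))) (phase-< (toℕ<p i))
      back-at-0 : phase ((p ∸ toℕ i) + (toℕ i + 0)) ≡ 0
      back-at-0 = begin
        phase ((p ∸ toℕ i) + (toℕ i + 0))  ≡⟨ cong phase (sym (+-assoc (p ∸ toℕ i) (toℕ i) 0)) ⟩
        phase ((p ∸ toℕ i) + toℕ i + 0)    ≡⟨ cong (λ x → phase (x + 0)) (m∸n+n≡m (<⇒≤ (toℕ<p i))) ⟩
        phase (p + 0)                      ≡⟨ phase-period 0 ⟩
        phase 0                            ≡⟨ phase-zero ⟩
        0                                  ∎
        where open ≡-Reasoning
      tour : Σ (On zero ((p ∸ toℕ i) + (toℕ i + 0))) Explores
      tour = fromHub ((p ∸ toℕ i) + (toℕ i + 0)) back-at-0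
      leave : π R zero (toℕ i + 0) ≡ π R (suc i) (toℕ i + 0)
      leave = sym (meets-hub i (toℕ i + 0) at-meet)

  feasible : Feasible R
  feasible .(π R c 0) (c , refl) = start c

  -- Lower bound: the agent must visit the key of every arm.  A set S of arms
  -- whose keys are still to be visited is a subset of Fin m.

  -- At phase 1 the hub meets the special arm; boarding it then is no saving
  -- unless its key is the only one left, since that key is best kept for last.
  twist : ℕ → Subset m → ℕ
  twist 1 S = ind (∣ S ∣ ≟ 1)
  twist _ _ = 1

  -- One move is saved when the hub currently meets an arm whose key is pending.
  discount : ℕ → Subset m → ℕ
  discount τ S = ind (hubArm τ ∈? S) * twist τ S

  -- Moves saved from the hub: the last key is not followed by a ride back, and
  -- visiting the special key last saves one more (its arm needs 2 steps back).
  bonus : ℕ → Subset m → ℕ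
  bonus τ S = 1 + ind (special ∈? S) + discount τ S

  -- From the hub every remaining key costs p + 1 moves (reach its arm, ride
  -- to the key, ride back), except for the savings counted by the bonus.
  hubPot : ℕ → Subset m → ℕ
  hubPot τ S = ∣ S ∣ * suc p ∸ bonus τ S

  -- From arm i: either get to the hub first, or visit key i first.
  toHub : Fin m → ℕ → Subset m → ℕ
  toHub i τ S = gap τ (toℕ i) + hubPot (toℕ i) S

  afterKey : Fin m → Subset m → ℕ
  afterKey i S = ifNonzero ∣ S - i ∣ (toHub i (keyTime i) (S - i))

  toKey : Fin m → ℕ → Subset m → ℕ
  toKey i τ S = gap τ (keyTime i) + afterKey i S

  armPot : Fin m → ℕ → Subset m → ℕ
  armPot i τ S = ifNonzero ∣ S ∣ (toHub i τ S ⊓ toKey i τ S)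

  potential : Fin (suc m) → ℕ → Subset m → ℕ
  potential zero    = hubPot
  potential (suc i) = armPot i

  twist≤1 : ∀ τ S → twist τ S ≤ 1
  twist≤1 0             _ = ≤-refl
  twist≤1 1             S = ind≤1 (∣ S ∣ ≟ 1)
  twist≤1 (suc (suc _)) _ = ≤-refl

  discount≤1 : ∀ τ S → discount τ S ≤ 1
  discount≤1 τ S = *-mono-≤ (ind≤1 (hubArm τ ∈? S)) (twist≤1 τ S)

  bonus≤3 : ∀ τ S → bonus τ S ≤ 3
  bonus≤3 τ S = +-mono-≤ (s≤s (ind≤1 (special ∈? S))) (discount≤1 τ S)

  twist-one : ∀ τ S → τ ≢ 1 ⊎ ∣ S ∣ ≡ 1 → twist τ S ≡ 1
  twist-one 0             _ _          = refl
  twist-one 1             _ (inj₁ τ≢1) = contradiction refl τ≢1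
  twist-one 1             S (inj₂ one) = ind-yes (∣ S ∣ ≟ 1) one
  twist-one (suc (suc _)) _ _          = refl

  discount-at-meet : ∀ i S → i ∈ S → toℕ i ≢ 1 ⊎ ∣ S ∣ ≡ 1 → discount (toℕ i) S ≡ 1
  discount-at-meet i S i∈S cond =
    cong₂ _*_ (ind-yes (hubArm (toℕ i) ∈? S) (subst (_∈ S) (sym (hubArm-toℕ i)) i∈S)) (twist-one (toℕ i) S cond)

  discount-after-key : ∀ i S → discount (toℕ i) (S - i) ≡ 0
  discount-after-key i S =
    cong (_* twist (toℕ i) (S - i)) (ind-no (hubArm (toℕ i) ∈? S - i) (x∉p-x ∘ subst (_∈ S - i) (hubArm-toℕ i)))

  special-unique : ∀ i → toℕ i ≡ 1 → i ≡ special
  special-unique i e = toℕ-injective (trans e (sym toℕ-special))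

  bonus-last : ∀ i S → i ∈ S → ∣ S ∣ ≡ 1 → suc (meetRow i) ≤ bonus (toℕ i) S
  bonus-last i S i∈S one with meetRow-cases (toℕ i)
  ... | inj₁ (is1 , ρ≡2) = ≤-reflexive (begin
    suc (meetRow i)                                ≡⟨ cong suc ρ≡2 ⟩
    1 + 1 + 1                                      ≡⟨ cong₂ (λ a d → 1 + a + d) (sym (ind-yes (special ∈? S) sp∈S))
                                                          (sym (discount-at-meet i S i∈S (inj₂ one))) ⟩
    1 + ind (special ∈? S) + discount (toℕ i) S    ∎)
    where
      open ≡-Reasoning
      sp∈S : special ∈ S
      sp∈S = subst (_∈ S) (special-unique i is1) i∈S
  ... | inj₂ (not1 , ρ≡1) = begin
    suc (meetRow i)                                ≡⟨ cong suc ρ≡1 ⟩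
    1 + 0 + 1                                      ≤⟨ +-monoˡ-≤ 1 (+-monoʳ-≤ 1 z≤n) ⟩
    1 + ind (special ∈? S) + 1                     ≡⟨ cong (1 + ind (special ∈? S) +_) (sym (discount-at-meet i S i∈S (inj₁ not1))) ⟩
    1 + ind (special ∈? S) + discount (toℕ i) S    ∎
    where open ≤-Reasoning

  bonus-many : ∀ i S → i ∈ S → suc (bonus (toℕ i) (S - i)) ≤ bonus (toℕ i) S
  bonus-many i S i∈S with meetRow-cases (toℕ i)
  ... | inj₁ (is1 , _) = begin
    suc (1 + ind (special ∈? S - i) + discount (toℕ i) (S - i))  ≡⟨ cong₂ (λ a d → suc (1 + a + d)) sp∉ (discount-after-key i S) ⟩
    1 + 1 + 0                                                     ≤⟨ +-monoʳ-≤ (1 + 1) z≤n ⟩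
    1 + 1 + discount (toℕ i) S                                    ≡⟨ cong (λ a → 1 + a + discount (toℕ i) S) (sym (ind-yes (special ∈? S) sp∈S)) ⟩
    1 + ind (special ∈? S) + discount (toℕ i) S                   ∎
    where
      open ≤-Reasoning
      i≡sp : i ≡ special
      i≡sp = special-unique i is1
      sp∈S : special ∈ S
      sp∈S = subst (_∈ S) i≡sp i∈S
      sp∉ : ind (special ∈? S - i) ≡ 0
      sp∉ = ind-no (special ∈? S - i) (x∉p-x ∘ subst (_∈ S - i) (sym i≡sp))
  ... | inj₂ (not1 , _) = begin
    suc (1 + ind (special ∈? S - i) + discount (toℕ i) (S - i))  ≡⟨ cong (λ d → suc (1 + ind (special ∈? S - i) + d)) (discount-after-key i S) ⟩
    suc (1 + ind (special ∈? S - i) + 0)                          ≡⟨ cong suc (+-identityʳ _) ⟩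
    1 + (1 + ind (special ∈? S - i))                              ≡⟨ +-comm 1 _ ⟩
    1 + ind (special ∈? S - i) + 1                                ≤⟨ +-monoˡ-≤ 1 (+-monoʳ-≤ 1 (ind-mono (special ∈? S - i) (special ∈? S) (p─q⊆p S ⁅ i ⁆))) ⟩
    1 + ind (special ∈? S) + 1                                    ≡⟨ cong (1 + ind (special ∈? S) +_) (sym (discount-at-meet i S i∈S (inj₁ not1))) ⟩
    1 + ind (special ∈? S) + discount (toℕ i) S                   ∎
    where open ≤-Reasoning

  hubPot-empty : ∀ τ S → ∣ S ∣ ≡ 0 → hubPot τ S ≡ 0
  hubPot-empty τ S none = cong (λ c → c * suc p ∸ bonus τ S) none

  last-key-arith : ∀ {ρ b} → suc ρ ≤ b → suc p + 0 ∸ b ≤ p ∸ ρ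
  last-key-arith {ρ} {b} sρ≤b = begin
    suc p + 0 ∸ b        ≤⟨ ∸-monoʳ-≤ (suc p + 0) sρ≤b ⟩
    p + 0 ∸ ρ            ≡⟨ cong (_∸ ρ) (+-identityʳ p) ⟩
    p ∸ ρ                ∎
    where open ≤-Reasoning

  many-keys-arith : ∀ {ρ N b b′} → ρ ≤ p → b′ ≤ N → suc b′ ≤ b →
                    suc p + N ∸ b ≤ (p ∸ ρ) + (ρ + (N ∸ b′))
  many-keys-arith {ρ} {N} {b} {b′} ρ≤p b′≤N sb′≤b = begin
    suc p + N ∸ b              ≤⟨ ∸-monoʳ-≤ (suc p + N) sb′≤b ⟩
    p + N ∸ b′                 ≡⟨ +-∸-assoc p b′≤N ⟩
    p + (N ∸ b′)               ≡⟨ cong (_+ (N ∸ b′)) (m∸n+n≡m ρ≤p) ⟨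
    (p ∸ ρ) + ρ + (N ∸ b′)     ≡⟨ +-assoc (p ∸ ρ) ρ (N ∸ b′) ⟩
    (p ∸ ρ) + (ρ + (N ∸ b′))   ∎
    where open ≤-Reasoning

  hub-before-key : ∀ i S → hubPot (toℕ i) S ≤ toKey i (toℕ i) S
  hub-before-key i S with i ∈? S
  ... | no i∉S = begin
    hubPot (toℕ i) S                         ≤⟨ ≤-ifNonzero ∣ S ∣ (hubPot-empty (toℕ i) S) (m≤n+m _ _) ⟩
    ifNonzero ∣ S ∣ (toHub i (keyTime i) S)  ≡⟨ cong (λ X → ifNonzero ∣ X ∣ (toHub i (keyTime i) X)) (x∉p⇒p-x≡p i∉S) ⟨
    afterKey i S                             ≤⟨ m≤n+m _ _ ⟩
    toKey i (toℕ i) S                        ∎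
    where open ≤-Reasoning
  ... | yes i∈S = by-rest ∣ S - i ∣ refl
    where
      open ≤-Reasoning
      size : ∣ S ∣ ≡ suc ∣ S - i ∣
      size = ∣p∣≡1+∣p-x∣ i∈S
      by-rest : ∀ c → ∣ S - i ∣ ≡ c → hubPot (toℕ i) S ≤ toKey i (toℕ i) S
      by-rest zero none = begin
        hubPot (toℕ i) S                         ≡⟨ cong (λ c → c * suc p ∸ bonus (toℕ i) S) (trans size (cong suc none)) ⟩
        suc p + 0 ∸ bonus (toℕ i) S              ≤⟨ last-key-arith (bonus-last i S i∈S (trans size (cong suc none))) ⟩
        p ∸ meetRow i                            ≡⟨ gap-meet-key i ⟨
        gap (toℕ i) (keyTime i)                  ≤⟨ m≤m+n _ _ ⟩
        toKey i (toℕ i) S                        ∎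
      by-rest (suc j) some = begin
        hubPot (toℕ i) S                         ≡⟨ cong (λ c → c * suc p ∸ bonus (toℕ i) S) (trans size (cong suc some)) ⟩
        suc p + N ∸ bonus (toℕ i) S              ≤⟨ many-keys-arith (<⇒≤ (meetRow<p i)) b′≤N (bonus-many i S i∈S) ⟩
        (p ∸ meetRow i) + (meetRow i + (N ∸ bonus (toℕ i) (S - i)))
          ≡⟨ cong₂ (λ g r → g + (r + (N ∸ bonus (toℕ i) (S - i)))) (gap-meet-key i) (row-at-meet i) ⟨
        gap (toℕ i) (keyTime i) + (row i (toℕ i) + (N ∸ bonus (toℕ i) (S - i)))
          ≡⟨ cong (λ c → gap (toℕ i) (keyTime i) + (row i (toℕ i) + (c * suc p ∸ bonus (toℕ i) (S - i)))) some ⟨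
        gap (toℕ i) (keyTime i) + toHub i (keyTime i) (S - i)
          ≡⟨ cong (gap (toℕ i) (keyTime i) +_) (ifNonzero-suc _ some) ⟨
        toKey i (toℕ i) S                        ∎
        where
          N : ℕ
          N = suc j * suc p
          b′≤N : bonus (toℕ i) (S - i) ≤ N
          b′≤N = ≤-trans (bonus≤3 (toℕ i) (S - i)) (≤-trans (n≤1+n 3) (≤-trans (s≤s 3≤p) (m≤m+n (suc p) _)))

  gap-self-meet : ∀ i → gap (toℕ i) (toℕ i) ≡ 0
  gap-self-meet i = gap-self (<⇒≤ (toℕ<p i))

  hub-to-arm : ∀ i S → hubPot (toℕ i) S ≤ armPot i (toℕ i) S
  hub-to-arm i S = ≤-ifNonzero ∣ S ∣ (hubPot-empty (toℕ i) S)
    (⊓-glb (≤-reflexive (cong (_+ hubPot (toℕ i) S) (sym (gap-self-meet i)))) (hub-before-key i S))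

  arm-to-hub : ∀ i S → armPot i (toℕ i) S ≤ hubPot (toℕ i) S
  arm-to-hub i S = ifNonzero-≤ ∣ S ∣
    (≤-trans (m⊓n≤m _ _) (≤-reflexive (cong (_+ hubPot (toℕ i) S) (gap-self-meet i))))

  potential-meeting : ∀ {c c′ τ} S → Meeting c c′ τ → potential c τ S ≤ potential c′ τ S
  potential-meeting S same          = ≤-refl
  potential-meeting S (hub-arm i) = hub-to-arm i S
  potential-meeting S (arm-hub i) = arm-to-hub i S

  hubPot-tick : ∀ τ τ′ S → hubPot τ S ≤ suc (hubPot τ′ S)
  hubPot-tick τ τ′ S = ∸-bits (∣ S ∣ * suc p) (1 + ind (special ∈? S)) (discount≤1 τ S) (discount≤1 τ′ S)

  armPot-tick : ∀ i t S → armPot i (phase t) S ≤ suc (armPot i (phase (suc t)) S)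
  armPot-tick i t S = ifNonzero-mono ∣ S ∣ λ _ →
    ⊓-mono-≤ (+-monoˡ-≤ (hubPot (toℕ i) S) (gap-tick t (toℕ i)))
             (+-monoˡ-≤ (afterKey i S) (gap-tick t (keyTime i)))

  armPot-at-key : ∀ i t S → phase t ≡ keyTime i → armPot i (phase t) S ≤ afterKey i S
  armPot-at-key i t S at-key = begin
    armPot i (phase t) S                        ≤⟨ ifNonzero-≤ ∣ S ∣ (m⊓n≤n _ _) ⟩
    gap (phase t) (keyTime i) + afterKey i S    ≡⟨ cong (λ τ → gap τ (keyTime i) + afterKey i S) at-key ⟩
    gap (keyTime i) (keyTime i) + afterKey i S  ≡⟨ cong (_+ afterKey i S) (gap-self (keyTime≤p i)) ⟩
    afterKey i S                                ∎
    where open ≤-Reasoning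

  armPot-key : ∀ i t S → phase t ≡ keyTime i → armPot i (phase t) S ≤ suc (armPot i (phase (suc t)) (S - i))
  armPot-key i t S at-key = begin
    armPot i (phase t) S                        ≤⟨ armPot-at-key i t S at-key ⟩
    afterKey i S                                ≤⟨ ifNonzero-mono ∣ S - i ∣ (λ some → ⊓-glb via-hub (via-key some)) ⟩
    suc (armPot i (phase (suc t)) (S - i))      ∎
    where
      open ≤-Reasoning
      via-hub : toHub i (keyTime i) (S - i) ≤ suc (toHub i (phase (suc t)) (S - i))
      via-hub = +-monoˡ-≤ _ (subst (λ τ → gap τ (toℕ i) ≤ suc (gap (phase (suc t)) (toℕ i))) at-key (gap-tick t (toℕ i)))
      via-key : ∀ {j} → ∣ S - i ∣ ≡ suc j → toHub i (keyTime i) (S - i) ≤ suc (toKey i (phase (suc t)) (S - i))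
      via-key some = begin
        toHub i (keyTime i) (S - i)       ≡⟨ ifNonzero-suc _ some ⟨
        afterKey i S                      ≡⟨ cong (λ X → ifNonzero ∣ X ∣ (toHub i (keyTime i) X)) (p─q─q≡p─q S ⁅ i ⁆) ⟨
        afterKey i (S - i)                ≤⟨ m≤n+m _ _ ⟩
        toKey i (phase (suc t)) (S - i)   ≤⟨ n≤1+n _ ⟩
        suc (toKey i (phase (suc t)) (S - i)) ∎

  KeysIn : Subset m → List (Fin n) → Set
  KeysIn S L = ∀ i → i ∈ S → key i ∈ₗ L

  keys-ahead : ∀ {S S′ x L} → KeysIn S (x ∷ L) → (∀ {i} → i ∈ S′ → i ∈ S × key i ≢ x) → KeysIn S′ L
  keys-ahead keys pending i i∈S′ with keys i (proj₁ (pending i∈S′))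
  ... | Any.here eq = contradiction eq (proj₂ (pending i∈S′))
  ... | Any.there k = k

  carrier-step : ∀ c t S {L} → KeysIn S (π R c t ∷ L) →
                 Σ (Subset m) λ S′ → KeysIn S′ L × potential c (phase t) S ≤ suc (potential c (phase (suc t)) S′)
  carrier-step zero t S keys =
    S , keys-ahead keys (λ {i} i∈S → i∈S , λ eq → 0≢1+i (proj₁ (key-located i zero t eq))) ,
    hubPot-tick (phase t) (phase (suc t)) S
    where
      0≢1+i : ∀ {i} → _≢_ {A = Fin (suc m)} zero (suc i)
      0≢1+i ()
  carrier-step (suc i) t S keys with phase t ≟ keyTime i
  ... | yes at-key =
    S - i , keys-ahead keys (λ {j} j∈ → p─q⊆p S ⁅ i ⁆ j∈ , λ eq →
                               x∉p-x (subst (_∈ S - i) (sym (Fin.suc-injective (proj₁ (key-located j (suc i) t eq)))) j∈)) ,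
    armPot-key i t S at-key
  ... | no off-key =
    S , keys-ahead keys (λ {j} j∈S → j∈S , λ eq → off-key (visited-at j eq)) , armPot-tick i t S
    where
      visited-at : ∀ j → key j ≡ π R (suc i) t → phase t ≡ keyTime i
      visited-at j eq with key-located j (suc i) t eq
      ... | refl , at-key = at-key

  -- A move: change to a co-located carrier (equal potential), then ride it.
  potential-move : ∀ c c′ t S {L} → π R c′ t ≡ π R c t → KeysIn S (π R c t ∷ L) →
                   Σ (Subset m) λ S′ → KeysIn S′ L × potential c (phase t) S ≤ suc (potential c′ (phase (suc t)) S′)
  potential-move c c′ t S e keys with carrier-step c′ t S (subst (λ x → KeysIn S (x ∷ _)) (sym e) keys)
  ... | S′ , keys′ , drop = S′ , keys′ , ≤-trans (potential-meeting S (colocated c c′ t (sym e))) drop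

  potential-empty : ∀ c τ S → ∣ S ∣ ≡ 0 → potential c τ S ≡ 0
  potential-empty zero    τ S none = hubPot-empty τ S none
  potential-empty (suc i) τ S none = ifNonzero-zero _ none

  potential-halt : ∀ c t S → KeysIn S (π R c t ∷ []) → potential c (phase t) S ≡ 0
  potential-halt c t S keys with nonempty? S
  ... | no empty = potential-empty c (phase t) S (Empty⇒∣p∣≡0 empty)
  ... | yes (i , i∈S) with key-located i c t (∈-singleton (keys i i∈S))
  ...   | refl , at-key = n≤0⇒n≡0 (≤-trans (armPot-at-key i t S at-key)
                                             (≤-reflexive (ifNonzero-zero _ (Empty⇒∣p∣≡0 others-visited))))
    where
      others-visited : Empty (S - i)
      others-visited (j , j∈) with key-located j (suc i) t (∈-singleton (keys j (p─q⊆p S ⁅ i ⁆ j∈)))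
      ... | refl , _ = x∉p-x j∈

  open PotentialBound R KeysIn (λ c t S → potential c (phase t) S) potential-halt potential-move

  m≡1+[m∸1] : m ≡ suc (m ∸ 1)
  m≡1+[m∸1] = sym (m+[n∸m]≡n (≤-trans (s≤s z≤n) 2≤m))

  ∣⊤∣≡1+[m∸1] : ∣ ⊤ {m} ∣ ≡ suc (m ∸ 1)
  ∣⊤∣≡1+[m∸1] = trans (∣⊤∣≡n m) m≡1+[m∸1]

  ∣⊤-special∣ : ∣ ⊤ - special ∣ ≡ m ∸ 1
  ∣⊤-special∣ = suc-injective (trans (sym (∣p∣≡1+∣p-x∣ {x = special} {⊤} ∈⊤)) ∣⊤∣≡1+[m∸1])

  meetRow-special : meetRow special ≡ 2
  meetRow-special = cong meetRow′ toℕ-special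

  keyTime-special : keyTime special ≡ p ∸ 1
  keyTime-special = begin
    (toℕ special + (p ∸ meetRow special)) % p  ≡⟨ cong₂ (λ a r → (a + (p ∸ r)) % p) toℕ-special meetRow-special ⟩
    (1 + (p ∸ 2)) % p                          ≡⟨ cong (_% p) (+-∸-assoc 1 (≤-trans (s≤s (s≤s z≤n)) 3≤p)) ⟨
    (p ∸ 1) % p                                ≡⟨ m<n⇒m%n≡m (∸-monoʳ-< (s≤s z≤n) (≤-trans (s≤s z≤n) 3≤p)) ⟩
    p ∸ 1                                      ∎
    where open ≡-Reasoning

  bonus-start : bonus 1 (⊤ {m}) ≡ 2
  bonus-start = cong₂ (λ a d → 1 + a + d) (ind-yes (special ∈? ⊤ {m}) ∈⊤) no-discount
    where
      not-single : ∣ ⊤ {m} ∣ ≢ 1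
      not-single one = <⇒≢ (∸-monoˡ-≤ 1 2≤m) (sym (suc-injective (trans (sym ∣⊤∣≡1+[m∸1]) one)))
      no-discount : discount 1 (⊤ {m}) ≡ 0
      no-discount = trans (cong (ind (hubArm 1 ∈? ⊤) *_) (ind-no (∣ ⊤ {m} ∣ ≟ 1) not-single)) (*-zeroʳ (ind (hubArm 1 ∈? ⊤)))

  bonus-after-special : bonus (toℕ special) (⊤ - special) ≡ 1
  bonus-after-special = cong₂ (λ a d → 1 + a + d) (ind-no (special ∈? ⊤ - special) x∉p-x) (discount-after-key special ⊤)

  start-hub-arith : ∀ {X} → 1 ≤ X → X + p ≡ 1 + (suc p + X ∸ 2)
  start-hub-arith {X} 1≤X = begin
    X + p                  ≡⟨ +-comm X p ⟩
    p + X                  ≡⟨ cong (p +_) (m+[n∸m]≡n 1≤X) ⟨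
    p + suc (X ∸ 1)        ≡⟨ +-suc p (X ∸ 1) ⟩
    suc (p + (X ∸ 1))      ≡⟨ cong suc (+-∸-assoc p 1≤X) ⟨
    1 + (suc p + X ∸ 2)    ∎
    where open ≡-Reasoning

  start-key-arith : ∀ {X} → 1 ≤ X → X + p ≡ (p ∸ 1) + (2 + (X ∸ 1))
  start-key-arith {X} 1≤X = begin
    X + p                         ≡⟨ +-comm X p ⟩
    p + X                         ≡⟨ cong₂ _+_ (m∸n+n≡m (≤-trans (s≤s z≤n) 3≤p)) (m+[n∸m]≡n 1≤X) ⟨
    (p ∸ 1) + 1 + (1 + (X ∸ 1))   ≡⟨ +-assoc (p ∸ 1) 1 (1 + (X ∸ 1)) ⟩
    (p ∸ 1) + (2 + (X ∸ 1))       ∎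
    where open ≡-Reasoning

  -- The agent placed on the special arm at time 0 faces potential
  -- (m - 1)(p + 1) + p: riding to the hub first or to the special key first
  -- both lead there.
  start-potential : (m ∸ 1) * suc p + p ≤ armPot special 0 ⊤
  start-potential = begin
    X + p                                ≤⟨ ⊓-glb (≤-reflexive via-hub) (≤-reflexive via-key) ⟩
    toHub special 0 ⊤ ⊓ toKey special 0 ⊤ ≡⟨ ifNonzero-suc _ ∣⊤∣≡1+[m∸1] ⟨
    armPot special 0 ⊤                   ∎
    where
      open ≤-Reasoning
      X : ℕ
      X = (m ∸ 1) * suc p
      1≤X : 1 ≤ X
      1≤X = *-mono-≤ (∸-monoˡ-≤ 1 2≤m) (s≤s z≤n)
      via-hub : X + p ≡ toHub special 0 ⊤
      via-hub = begin-equality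
        X + p                                       ≡⟨ start-hub-arith 1≤X ⟩
        1 + (suc p + X ∸ 2)                         ≡⟨ cong₂ (λ g b → g + (suc p + X ∸ b)) (gap-from-zero (≤-trans (s≤s (s≤s z≤n)) 3≤p)) bonus-start ⟨
        gap 0 1 + (suc (m ∸ 1) * suc p ∸ bonus 1 ⊤)  ≡⟨ cong (λ c → gap 0 1 + (c * suc p ∸ bonus 1 ⊤)) ∣⊤∣≡1+[m∸1] ⟨
        gap 0 1 + hubPot 1 ⊤                        ≡⟨ cong (λ τ → gap 0 τ + hubPot τ ⊤) toℕ-special ⟨
        toHub special 0 ⊤                           ∎
      rest : ∣ ⊤ - special ∣ ≡ suc (m ∸ 1 ∸ 1)
      rest = trans ∣⊤-special∣ (sym (m+[n∸m]≡n (∸-monoˡ-≤ 1 2≤m)))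
      via-key : X + p ≡ toKey special 0 ⊤
      via-key = begin-equality
        X + p                                       ≡⟨ start-key-arith 1≤X ⟩
        (p ∸ 1) + (2 + (X ∸ 1))                     ≡⟨ cong₂ (λ g r → g + (r + (X ∸ 1))) (trans (gap-from-zero (keyTime<p special)) keyTime-special) (trans (row-at-meet special) meetRow-special) ⟨
        gap 0 (keyTime special) + (row special (toℕ special) + (X ∸ 1))
          ≡⟨ cong (λ b → gap 0 (keyTime special) + (row special (toℕ special) + (X ∸ b))) bonus-after-special ⟨
        gap 0 (keyTime special) + (row special (toℕ special) + ((m ∸ 1) * suc p ∸ bonus (toℕ special) (⊤ - special)))
          ≡⟨ cong (λ c → gap 0 (keyTime special) + (row special (toℕ special) + (c * suc p ∸ bonus (toℕ special) (⊤ - special)))) ∣⊤-special∣ ⟨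
        gap 0 (keyTime special) + toHub special (keyTime special) (⊤ - special)
          ≡⟨ cong (gap 0 (keyTime special) +_) (ifNonzero-suc _ rest) ⟨
        toKey special 0 ⊤                           ∎

  lower : MovesAtLeast R ((m ∸ 1) * suc p + p)
  lower σ = π R (suc special) 0 , (suc special , refl) , (begin
      (m ∸ 1) * suc p + p                   ≤⟨ start-potential ⟩
      armPot special 0 ⊤                    ≡⟨ cong (λ τ → armPot special τ ⊤) phase-zero ⟨
      potential (suc special) (phase 0) ⊤   ≤⟨ potential-bound (suc special) 0 ⊤ (proj₁ run) (λ i _ → proj₂ run (key i)) ⟩
      moves (proj₁ run)                     ∎)
    where
      open ≤-Reasoning
      run : Σ (On (suc special) 0) Explores
      run = σ (π R (suc special) 0) (suc special , refl)

MovesAtLeast-weaken : ∀ {n k p} .{{_ : NonZero p}} {R : PVSystem n k p} {B B′} →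
                      B′ ≤ B → MovesAtLeast R B → MovesAtLeast R B′
MovesAtLeast-weaken B′≤B forced σ with forced σ
... | x , s , bound = x , s , ≤-trans B′≤B bound

ceilDiv-bound : ∀ n d {p} → ceilDiv n (suc d) ≤ p → n ≤ suc d * p
ceilDiv-bound n d {p} ceil≤p = +-cancelʳ-≤ d n (suc d * p) (begin
  n + d                                   ≡⟨ m≡m%n+[m/n]*n (n + d) (suc d) ⟩
  (n + d) % suc d + (n + d) / suc d * suc d ≤⟨ +-mono-≤ (s≤s⁻¹ (m%n<n (n + d) (suc d))) (*-monoˡ-≤ (suc d) ceil≤p) ⟩
  d + p * suc d                           ≡⟨ cong (d +_) (*-comm p (suc d)) ⟩
  d + suc d * p                           ≡⟨ +-comm d _ ⟩
  suc d * p + d                           ∎)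
  where open ≤-Reasoning

floorDiv≤ceilDiv : ∀ n d → floorDiv n (suc d) ≤ ceilDiv n (suc d)
floorDiv≤ceilDiv n d = /-monoˡ-≤ (suc d) (m≤m+n n d)

three<p : ∀ d {n p} → 3 * suc (suc d) ≤ n → n ≤ suc d * p → 3 < p
three<p d {n} {p} 3k≤n n≤mp = *-cancelʳ-< (suc d) 3 p (begin-strict
  3 * suc d         <⟨ *-monoʳ-< 3 (n<1+n (suc d)) ⟩
  3 * suc (suc d)   ≤⟨ 3k≤n ⟩
  n                 ≤⟨ n≤mp ⟩
  suc d * p         ≡⟨ *-comm (suc d) p ⟩
  p * suc d         ∎)
  where open ≤-Reasoning

-- With m = k - 1 the construction forces (m - 1)(p + 1) + p moves, and
-- ⌊n/m⌋ ≤ ⌈n/m⌉ ≤ p.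
theorem3 : (n k p : ℕ) .{{_ : NonZero p}} → 9 ≤ n → 3 * k ≤ n → 3 ≤ k →
           (k ∸ 1) ⊔ ceilDiv n (k ∸ 1) ≤ p →
           Σ (PVSystem n k p) λ R →
             Feasible R × MovesAtLeast R ((k ∸ 2) * (p + 1) + floorDiv n (k ∸ 1))
theorem3 n (suc (suc d)) p _ 3k≤n (s≤s 2≤m) bounds =
  C.R , C.feasible , MovesAtLeast-weaken (+-mono-≤ (≤-reflexive (cong (d *_) (+-comm p 1))) floor≤p) C.lower
  where
    m≤p : suc d ≤ p
    m≤p = ≤-trans (m≤m⊔n (suc d) (ceilDiv n (suc d))) bounds
    ceil≤p : ceilDiv n (suc d) ≤ p
    ceil≤p = ≤-trans (m≤n⊔m (suc d) _) bounds
    floor≤p : floorDiv n (suc d) ≤ p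
    floor≤p = ≤-trans (floorDiv≤ceilDiv n d) ceil≤p
    n≤mp : n ≤ suc d * p
    n≤mp = ceilDiv-bound n d ceil≤p
    module C = Construction (suc d) n p 2≤m (≤-trans (*-monoʳ-≤ 3 (n≤1+n (suc d))) 3k≤n) m≤p
                            (<⇒≤ (three<p d 3k≤n n≤mp)) n≤mp
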